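{- Let $s\ge4$ and let $G$ be a finite simple undirected graph containing a copy $H$ of the $s$-gate as an induced subgraph, with $V(G)\setminus V(H)\neq\emptyset$, such that the edges of $G$ with exactly one endpoint in $V(H)$ are exactly $s$ external edges, one incident to each attachment vertex of $H$. Then every Hamiltonian cycle of $G$, upon entering $H$, traverses every vertex of $H$ before exiting; i.e. every Hamiltonian cycle of $G$ contains exactly two external edges of $H$.
   Context: For an integer $s\ge4$, the $s$-gate is the simple undirected graph with vertex set $\{1,\dots,10\}\cup\{b_1,\dots,b_{2s-7}\}$ and edges $\{1,3\},\{1,8\},\{2,3\},\{2,5\},\{3,4\},\{4,5\},\{4,6\},\{6,7\},\{7,8\},\{7,10\},\{8,9\},\{9,10\}$, $\{5,b_1\}$, $\{10,b_{2s-7}\}$, $\{b_i,b_{i+1}\}$ ($1\le i\le 2s-8$) and $\{1,b_{2j}\}$ ($1\le j\le s-4$). Its attachment vertices are $1,2,9,b_1,b_3,\dots,b_{2s-7}$ ($s$ of them). -}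

module Defs where

open import Data.Nat using (ℕ; zero; suc; _+_; _*_; _∸_; _≤_)
open import Data.Fin using (Fin; toℕ; zero; suc)
open import Data.Sum using (_⊎_; inj₁; inj₂)
open import Data.Product using (_×_; Σ; ∃; ∃-syntax; _,_)
open import Relation.Binary.PropositionalEquality using (_≡_)
open import Relation.Nullary using (¬_)
open import Function.Definitions using (Injective; Surjective)

record Graph (n : ℕ) : Set₁ where
  field
    Adj    : Fin n → Fin n → Set
    sym    : ∀ {u v} → Adj u v → Adj v u
    irrefl : ∀ {u} → ¬ Adj u u

-- The s-gate.
-- Vertex set: inj₁ i (i : Fin 10) is the vertex  toℕ i + 1  (so 1..10),
--             inj₂ k (k : Fin (2s-7)) is the vertex  b_{toℕ k + 1}.

GateV : ℕ → Set
GateV s = Fin 10 ⊎ Fin (2 * s ∸ 7)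

v1 v2 v3 v4 v5 v6 v7 v8 v9 v10 : Fin 10
v1  = zero
v2  = (suc zero)
v3  = (suc (suc zero))
v4  = (suc (suc (suc zero)))
v5  = (suc (suc (suc (suc zero))))
v6  = (suc (suc (suc (suc (suc zero)))))
v7  = (suc (suc (suc (suc (suc (suc zero))))))
v8  = (suc (suc (suc (suc (suc (suc (suc zero)))))))
v9  = (suc (suc (suc (suc (suc (suc (suc (suc zero))))))))
v10 = (suc (suc (suc (suc (suc (suc (suc (suc (suc zero)))))))))

data GateEdge (s : ℕ) : GateV s → GateV s → Set where
  e1-3  : GateEdge s (inj₁ v1) (inj₁ v3)
  e1-8  : GateEdge s (inj₁ v1) (inj₁ v8)
  e2-3  : GateEdge s (inj₁ v2) (inj₁ v3)
  e2-5  : GateEdge s (inj₁ v2) (inj₁ v5)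
  e3-4  : GateEdge s (inj₁ v3) (inj₁ v4)
  e4-5  : GateEdge s (inj₁ v4) (inj₁ v5)
  e4-6  : GateEdge s (inj₁ v4) (inj₁ v6)
  e6-7  : GateEdge s (inj₁ v6) (inj₁ v7)
  e7-8  : GateEdge s (inj₁ v7) (inj₁ v8)
  e7-10 : GateEdge s (inj₁ v7) (inj₁ v10)
  e8-9  : GateEdge s (inj₁ v8) (inj₁ v9)
  e9-10 : GateEdge s (inj₁ v9) (inj₁ v10)
  e5-b1 : (k : Fin (2 * s ∸ 7)) → toℕ k ≡ 0 → GateEdge s (inj₁ v5) (inj₂ k)
  e10-blast : (k : Fin (2 * s ∸ 7)) → suc (toℕ k) ≡ 2 * s ∸ 7 →
              GateEdge s (inj₁ v10) (inj₂ k)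
  eb-b  : (k l : Fin (2 * s ∸ 7)) → toℕ l ≡ suc (toℕ k) →
          GateEdge s (inj₂ k) (inj₂ l)
  -- {1, b_{2j}},  1 ≤ j ≤ s-4
  e1-beven : (k : Fin (2 * s ∸ 7)) (j : ℕ) → 1 ≤ j → j ≤ s ∸ 4 →
             suc (toℕ k) ≡ 2 * j → GateEdge s (inj₁ v1) (inj₂ k)

GateAdj : (s : ℕ) → GateV s → GateV s → Set
GateAdj s u v = GateEdge s u v ⊎ GateEdge s v u

data Attachment (s : ℕ) : GateV s → Set where
  at1 : Attachment s (inj₁ v1)
  at2 : Attachment s (inj₁ v2)
  at9 : Attachment s (inj₁ v9)
  atb : (k : Fin (2 * s ∸ 7)) (j : ℕ) → suc (toℕ k) ≡ 2 * j + 1 →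
        Attachment s (inj₂ k)

module _ {n : ℕ} (G : Graph n) (s : ℕ) where
  open Graph G

  IsInducedCopy : (GateV s → Fin n) → Set
  IsInducedCopy f = Injective _≡_ _≡_ f ×
                    (∀ u v → (GateAdj s u v → Adj (f u) (f v)) ×
                             (Adj (f u) (f v) → GateAdj s u v))

  InH : (GateV s → Fin n) → Fin n → Set
  InH f w = ∃[ u ] f u ≡ w

  ExternalEdgesCondition : (GateV s → Fin n) → Set
  ExternalEdgesCondition f =
    (∀ u → Attachment s u →
       ∃[ w ] ((¬ InH f w × Adj (f u) w) ×
               (∀ w′ → ¬ InH f w′ → Adj (f u) w′ → w′ ≡ w))) ×
    (∀ u → ¬ Attachment s u → ∀ w → ¬ InH f w → ¬ Adj (f u) w)

Next : (n : ℕ) → Fin n → Fin n → Set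
Next n i j = (toℕ j ≡ suc (toℕ i)) ⊎ (suc (toℕ i) ≡ n × toℕ j ≡ 0)

record HamiltonianCycle {n : ℕ} (G : Graph n) : Set where
  field
    size   : 3 ≤ n
    order  : Fin n → Fin n
    inj    : Injective _≡_ _≡_ order
    surj   : Surjective _≡_ _≡_ order
    adjacent : ∀ i j → Next n i j → Graph.Adj G (order i) (order j)

CrossesAt : ∀ {n} (G : Graph n) (s : ℕ) (f : GateV s → Fin n) →
            HamiltonianCycle G → Fin n → Fin n → Set
CrossesAt G s f C i j =
  Next _ i j ×
  ((InH G s f (order i) × ¬ InH G s f (order j)) ⊎
   (¬ InH G s f (order i) × InH G s f (order j)))
  where open HamiltonianCycle C

ExactlyTwoExternal : ∀ {n} (G : Graph n) (s : ℕ) (f : GateV s → Fin n) →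
                     HamiltonianCycle G → Set
ExactlyTwoExternal G s f C =
  ∃[ i₁ ] ∃[ j₁ ] ∃[ i₂ ] ∃[ j₂ ]
    (¬ i₁ ≡ i₂ × CrossesAt G s f C i₁ j₁ × CrossesAt G s f C i₂ j₂ ×
     (∀ i j → CrossesAt G s f C i j → i ≡ i₁ ⊎ i ≡ i₂))

-- The s-gate is bipartite, with colour classes A = {1, 2, 4, 7, 9, b₁, b₃, …, b_{2s-7}} and
-- B = {3, 5, 6, 8, 10, b₂, b₄, …, b_{2s-8}}; every attachment vertex lies in A and |A| = |B| + 1.
-- A Hamiltonian cycle C has degree 2 at every vertex, every edge of C inside H joins A to B, and
-- the vertices of B, not being attachments, have no neighbours outside H.  Counting the edges of C
-- at A and at B therefore shows that exactly 2|A| − 2|B| = 2 edges of C leave H.  As each vertex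
-- of H has at most one neighbour outside H, these are two distinct crossings of the cycle, and
-- there are no others.

module Submission where

open import Defs
open import Data.Bool using (Bool; true; false; T; not)
open import Data.Unit using (tt)
open import Data.Empty using (⊥; ⊥-elim)
import Data.Fin as Fin
open import Data.Fin using (Fin; zero; suc; toℕ; fromℕ; fromℕ<; inject₁)
open import Data.Fin.Properties
  using (toℕ-injective; toℕ<n; toℕ-fromℕ; toℕ-fromℕ<; toℕ-inject₁; any?)
  renaming (_≟_ to _≟ᶠ_)
open import Data.List using (List; []; _∷_; _++_; map; length; filter; allFin)
open import Data.List.Membership.Propositional using (_∈_; _∉_)
open import Data.List.Membership.Propositional.Properties
  using (∈-map⁺; ∈-map⁻; ∈-++⁺ˡ; ∈-++⁺ʳ; ∈-filter⁺; ∈-filter⁻; ∈-allFin)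
open import Data.List.Properties
  using (map-cong; map-++; length-map; filter-++; filter-accept; filter-reject; map-tabulate)
open import Data.List.Relation.Binary.Disjoint.Propositional using (Disjoint)
open import Data.List.Relation.Unary.All as All using (All)
open import Data.List.Relation.Unary.Any using (here; there)
open import Data.List.Relation.Unary.Unique.Propositional using (Unique; _∷_)
import Data.List.Relation.Unary.Unique.Propositional.Properties as Unique
import Data.List.Relation.Unary.All.Properties as AllP
open import Data.Nat using (ℕ; zero; suc; _+_; _*_; _∸_; _≤_; z≤n; s≤s; _<?_)
open import Data.Nat.ListAction using (sum)
open import Data.Nat.ListAction.Properties using (sum-++)
open import Data.Nat.Properties
  using (+-comm; *-suc; *-zeroʳ; suc-injective; ≤∧≮⇒≡; n≤1⇒n≡0∨n≡1; +-cancelʳ-≡; <-irrefl;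
         <-asym; ≤-reflexive; ≤-pred; ≤⇒≯; 0≢1+n; +-identityʳ; *-distribˡ-+; +-commutativeSemigroup)
import Data.Product as Product
open import Data.Product using (_×_; ∃; ∃-syntax; _,_; proj₁; proj₂)
import Data.Sum as Sum
open import Data.Sum using (_⊎_; inj₁; inj₂)
open import Data.Vec using (_∷_; []; lookup)
open import Function using (_∘_; id)
open import Relation.Binary.Definitions using (DecidableEquality)
open import Relation.Binary.PropositionalEquality
open import Relation.Nullary using (¬_; Dec; yes; no; ¬?; does)
open import Relation.Nullary.Decidable using (T?; decidable-stable; ¬¬-excluded-middle)
open import Relation.Unary using (Pred; Decidable)
open import Algebra.Properties.CommutativeSemigroup +-commutativeSemigroup
  renaming (interchange to +-interchange)

indicator : ∀ {p} {P : Set p} → Dec P → ℕ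
indicator (yes _) = 1
indicator (no _)  = 0

indicator-cong : ∀ {p q} {P : Set p} {Q : Set q} → (P → Q) → (Q → P) →
                 (P? : Dec P) (Q? : Dec Q) → indicator P? ≡ indicator Q?
indicator-cong P→Q Q→P (yes p) (yes q) = refl
indicator-cong P→Q Q→P (yes p) (no ¬q) = ⊥-elim (¬q (P→Q p))
indicator-cong P→Q Q→P (no ¬p) (yes q) = ⊥-elim (¬p (Q→P q))
indicator-cong P→Q Q→P (no ¬p) (no ¬q) = refl

private
  variable
    A B : Set

sum-map-+ : (g h : A → ℕ) (xs : List A) →
            sum (map (λ x → g x + h x) xs) ≡ sum (map g xs) + sum (map h xs)
sum-map-+ g h []       = refl
sum-map-+ g h (x ∷ xs) = begin
  g x + h x + sum (map (λ x → g x + h x) xs)     ≡⟨ cong (g x + h x +_) (sum-map-+ g h xs) ⟩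
  g x + h x + (sum (map g xs) + sum (map h xs)) ≡⟨ +-interchange (g x) (h x) _ _ ⟩
  g x + sum (map g xs) + (h x + sum (map h xs)) ∎
  where open ≡-Reasoning

sum-map-const : ∀ {g : A → ℕ} {c xs} → (∀ {x} → x ∈ xs → g x ≡ c) →
                sum (map g xs) ≡ c * length xs
sum-map-const {c = c} {xs = []} g≡c = sym (*-zeroʳ c)
sum-map-const {g = g} {c = c} {xs = x ∷ xs} g≡c = begin
  g x + sum (map g xs) ≡⟨ cong₂ _+_ (g≡c (here refl)) (sum-map-const (g≡c ∘ there)) ⟩
  c + c * length xs    ≡⟨ sym (*-suc c (length xs)) ⟩
  c * suc (length xs)  ∎
  where open ≡-Reasoning

sum-map-swap : (h : A → B → ℕ) (xs : List A) (ys : List B) →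
               sum (map (λ x → sum (map (h x) ys)) xs) ≡
               sum (map (λ y → sum (map (λ x → h x y) xs)) ys)
sum-map-swap h []       ys = sym (sum-map-const {c = 0} {ys} (λ _ → refl))
sum-map-swap h (x ∷ xs) ys = begin
  sum (map (h x) ys) + sum (map (λ x → sum (map (h x) ys)) xs)
    ≡⟨ cong (sum (map (h x) ys) +_) (sum-map-swap h xs ys) ⟩
  sum (map (h x) ys) + sum (map (λ y → sum (map (λ x → h x y) xs)) ys)
    ≡⟨ sym (sum-map-+ (h x) (λ y → sum (map (λ x → h x y) xs)) ys) ⟩
  sum (map (λ y → h x y + sum (map (λ x → h x y) xs)) ys) ∎
  where open ≡-Reasoning

filter-map : ∀ {p} {P : Pred B p} (P? : Decidable P) (g : A → B) xs →
             filter P? (map g xs) ≡ map g (filter (P? ∘ g) xs)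
filter-map P? g []       = refl
filter-map P? g (x ∷ xs) with does (P? (g x))
... | true  = cong (g x ∷_) (filter-map P? g xs)
... | false = filter-map P? g xs

module _ {A : Set} (_≟_ : DecidableEquality A) where

  count : A → List A → ℕ
  count z xs = sum (map (λ x → indicator (x ≟ z)) xs)

  count-∉ : ∀ {z xs} → z ∉ xs → count z xs ≡ 0
  count-∉ {z} {[]}     z∉xs = refl
  count-∉ {z} {x ∷ xs} z∉xs with x ≟ z
  ... | yes refl = ⊥-elim (z∉xs (here refl))
  ... | no _     = count-∉ (z∉xs ∘ there)

  count-∈ : ∀ {z xs} → Unique xs → z ∈ xs → count z xs ≡ 1
  count-∈ {z} {x ∷ xs} u@(_ ∷ uxs) z∈ with x ≟ z | z∈
  ... | yes refl | _         = cong suc (count-∉ (Unique.Unique[x∷xs]⇒x∉xs u))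
  ... | no x≢z   | here refl = ⊥-elim (x≢z refl)
  ... | no _     | there z∈xs = count-∈ uxs z∈xs

module _ {A : Set} (g : A → ℕ) where

  private
    nonzero? : Decidable (λ x → ¬ g x ≡ 0)
    nonzero? x = ¬? (g x Data.Nat.≟ 0)

  sum-map≡length-nonzero : ∀ {xs} → (∀ {x} → x ∈ xs → g x ≤ 1) →
                           sum (map g xs) ≡ length (filter nonzero? xs)
  sum-map≡length-nonzero {[]}     g≤1 = refl
  sum-map≡length-nonzero {x ∷ xs} g≤1 with n≤1⇒n≡0∨n≡1 (g≤1 (here refl))
  ... | inj₁ gx≡0 = begin
    g x + sum (map g xs)
      ≡⟨ cong₂ _+_ gx≡0 (sum-map≡length-nonzero (g≤1 ∘ there)) ⟩
    length (filter nonzero? xs)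
      ≡⟨ cong length (sym (filter-reject nonzero? (λ gx≢0 → gx≢0 gx≡0))) ⟩
    length (filter nonzero? (x ∷ xs)) ∎
    where open ≡-Reasoning
  ... | inj₂ gx≡1 = begin
    g x + sum (map g xs)
      ≡⟨ cong₂ _+_ gx≡1 (sum-map≡length-nonzero (g≤1 ∘ there)) ⟩
    suc (length (filter nonzero? xs))
      ≡⟨ cong length (sym (filter-accept nonzero? (λ gx≡0 → 0≢1+n (trans (sym gx≡0) gx≡1)))) ⟩
    length (filter nonzero? (x ∷ xs)) ∎
    where open ≡-Reasoning

  ExactlyTwoNonzero : List A → Set
  ExactlyTwoNonzero xs = ∃[ x₁ ] ∃[ x₂ ]
    (¬ x₁ ≡ x₂ × (x₁ ∈ xs × ¬ g x₁ ≡ 0) × (x₂ ∈ xs × ¬ g x₂ ≡ 0) ×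
     (∀ {x} → x ∈ xs → ¬ g x ≡ 0 → x ≡ x₁ ⊎ x ≡ x₂))

  two-nonzero : ∀ {xs} → Unique xs → (∀ {x} → x ∈ xs → g x ≤ 1) → sum (map g xs) ≡ 2 →
                ExactlyTwoNonzero xs
  two-nonzero {xs} u g≤1 sum≡2 =
    support (filter nonzero? xs) refl (trans (sym (sum-map≡length-nonzero g≤1)) sum≡2)
    where
    support : ∀ ys → filter nonzero? xs ≡ ys → length ys ≡ 2 → ExactlyTwoNonzero xs
    support (x₁ ∷ x₂ ∷ []) filter≡ _ =
      x₁ , x₂ , x₁≢x₂ , nonzero (here refl) , nonzero (there (here refl)) , only
      where
      nonzero : ∀ {x} → x ∈ x₁ ∷ x₂ ∷ [] → x ∈ xs × ¬ g x ≡ 0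
      nonzero x∈ = ∈-filter⁻ nonzero? (subst (_ ∈_) (sym filter≡) x∈)
      x₁≢x₂ : ¬ x₁ ≡ x₂
      x₁≢x₂ with subst Unique filter≡ (Unique.filter⁺ nonzero? u)
      ... | (x₁≢x₂ All.∷ _) ∷ _ = x₁≢x₂
      only : ∀ {x} → x ∈ xs → ¬ g x ≡ 0 → x ≡ x₁ ⊎ x ≡ x₂
      only x∈ gx≢0 with subst (_ ∈_) filter≡ (∈-filter⁺ nonzero? x∈ gx≢0)
      ... | here x≡x₁         = inj₁ x≡x₁
      ... | there (here x≡x₂) = inj₂ x≡x₂

next : ∀ {n} (i : Fin n) → ∃ (Next n i)
next {suc m} i with suc (toℕ i) <? suc m
... | yes i+1<n = fromℕ< i+1<n , inj₁ (toℕ-fromℕ< i+1<n)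
... | no  i+1≮n = zero , inj₂ (≤∧≮⇒≡ (toℕ<n i) i+1≮n , refl)

prev : ∀ {n} (j : Fin n) → ∃ λ i → Next n i j
prev {suc m} zero    = fromℕ m , inj₂ (cong suc (toℕ-fromℕ m) , refl)
prev {suc m} (suc j) = inject₁ j , inj₁ (cong suc (sym (toℕ-inject₁ j)))

module _ {n : ℕ} where

  Next-functional : ∀ {i j j′} → Next n i j → Next n i j′ → j ≡ j′
  Next-functional (inj₁ j≡) (inj₁ j′≡) = toℕ-injective (trans j≡ (sym j′≡))
  Next-functional {j = j} (inj₁ j≡) (inj₂ (i+1≡n , _)) =
    ⊥-elim (<-irrefl (trans j≡ i+1≡n) (toℕ<n j))
  Next-functional {j′ = j′} (inj₂ (i+1≡n , _)) (inj₁ j′≡) =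
    ⊥-elim (<-irrefl (trans j′≡ i+1≡n) (toℕ<n j′))
  Next-functional (inj₂ (_ , j≡0)) (inj₂ (_ , j′≡0)) = toℕ-injective (trans j≡0 (sym j′≡0))

  Next-injective : ∀ {i i′ j} → Next n i j → Next n i′ j → i ≡ i′
  Next-injective (inj₁ j≡) (inj₁ j≡′)       = toℕ-injective (suc-injective (trans (sym j≡) j≡′))
  Next-injective (inj₁ j≡) (inj₂ (_ , j≡0)) = ⊥-elim (0≢1+n (trans (sym j≡0) j≡))
  Next-injective (inj₂ (_ , j≡0)) (inj₁ j≡) = ⊥-elim (0≢1+n (trans (sym j≡0) j≡))
  Next-injective (inj₂ (i+1≡n , _)) (inj₂ (i′+1≡n , _)) =
    toℕ-injective (suc-injective (trans i+1≡n (sym i′+1≡n)))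

  private
    too-short : ∀ {k} → 3 ≤ n → n ≡ suc k → k ≤ 1 → ⊥
    too-short 3≤n refl k≤1 = ≤⇒≯ k≤1 (≤-pred 3≤n)

  Next-asymmetric : 3 ≤ n → ∀ {i j} → Next n i j → ¬ Next n j i
  Next-asymmetric _   (inj₁ j≡) (inj₁ i≡) = <-asym (≤-reflexive (sym j≡)) (≤-reflexive (sym i≡))
  Next-asymmetric 3≤n (inj₁ j≡) (inj₂ (j+1≡n , i≡0)) =
    too-short 3≤n (trans (sym j+1≡n) (cong suc (trans j≡ (cong suc i≡0)))) (s≤s z≤n)
  Next-asymmetric 3≤n (inj₂ (i+1≡n , j≡0)) (inj₁ i≡) =
    too-short 3≤n (trans (sym i+1≡n) (cong suc (trans i≡ (cong suc j≡0)))) (s≤s z≤n)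
  Next-asymmetric 3≤n (inj₂ (i+1≡n , j≡0)) (inj₂ (j+1≡n , _)) =
    too-short 3≤n (trans (sym j+1≡n) (cong suc j≡0)) z≤n

module CycleNeighbours {n : ℕ} {G : Graph n} (C : HamiltonianCycle G) where
  open Graph G using (Adj)
  open HamiltonianCycle C

  position : Fin n → Fin n
  position x = proj₁ (surj x)

  order-position : ∀ x → order (position x) ≡ x
  order-position x = proj₂ (surj x) refl

  position-order : ∀ i → position (order i) ≡ i
  position-order i = inj (order-position (order i))

  successor predecessor : Fin n → Fin n
  successor   x = order (proj₁ (next (position x)))
  predecessor x = order (proj₁ (prev (position x)))

  Next⇒successor : ∀ {i j} → Next n i j → order j ≡ successor (order i)
  Next⇒successor {i} {j} i→j = cong order (begin
    j                              ≡⟨ Next-functional i→j (proj₂ (next i)) ⟩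
    proj₁ (next i)                 ≡⟨ cong (proj₁ ∘ next) (sym (position-order i)) ⟩
    proj₁ (next (position (order i))) ∎)
    where open ≡-Reasoning

  Next⇒predecessor : ∀ {i j} → Next n i j → order i ≡ predecessor (order j)
  Next⇒predecessor {i} {j} i→j = cong order (begin
    i                              ≡⟨ Next-injective i→j (proj₂ (prev j)) ⟩
    proj₁ (prev j)                 ≡⟨ cong (proj₁ ∘ prev) (sym (position-order j)) ⟩
    proj₁ (prev (position (order j))) ∎)
    where open ≡-Reasoning

  predecessor-successor : ∀ x → predecessor (successor x) ≡ x
  predecessor-successor x =
    trans (sym (Next⇒predecessor (proj₂ (next (position x))))) (order-position x)

  successor-predecessor : ∀ x → successor (predecessor x) ≡ x
  successor-predecessor x =
    trans (sym (Next⇒successor (proj₂ (prev (position x))))) (order-position x)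

  successor≢predecessor : ∀ x → ¬ successor x ≡ predecessor x
  successor≢predecessor x s≡p =
    Next-asymmetric size (proj₂ (next (position x)))
      (subst (λ i → Next n i (position x)) (sym (inj s≡p)) (proj₂ (prev (position x))))

  Adj-successor : ∀ x → Adj x (successor x)
  Adj-successor x =
    subst (λ y → Adj y (successor x)) (order-position x) (adjacent _ _ (proj₂ (next (position x))))

  Adj-predecessor : ∀ x → Adj x (predecessor x)
  Adj-predecessor x = Graph.sym G
    (subst (Adj (predecessor x)) (order-position x) (adjacent _ _ (proj₂ (prev (position x)))))

  ≡successor⇒≡predecessor : ∀ {x y} → y ≡ successor x → x ≡ predecessor y
  ≡successor⇒≡predecessor {x} refl = sym (predecessor-successor x)

  ≡predecessor⇒≡successor : ∀ {x y} → x ≡ predecessor y → y ≡ successor x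
  ≡predecessor⇒≡successor {y = y} refl = sym (successor-predecessor y)

  cycleEdges : Fin n → Fin n → ℕ
  cycleEdges x y = indicator (y ≟ᶠ successor x) + indicator (y ≟ᶠ predecessor x)

  cycleEdges-sym : ∀ x y → cycleEdges x y ≡ cycleEdges y x
  cycleEdges-sym x y = trans
    (cong₂ _+_ (indicator-cong ≡successor⇒≡predecessor ≡predecessor⇒≡successor
                               (y ≟ᶠ successor x) (x ≟ᶠ predecessor y))
               (indicator-cong ≡predecessor⇒≡successor ≡successor⇒≡predecessor
                               (y ≟ᶠ predecessor x) (x ≟ᶠ successor y)))
    (+-comm (indicator (x ≟ᶠ predecessor y)) (indicator (x ≟ᶠ successor y)))

  module Boundary (Q : Fin n → Set) (Q? : Decidable Q) where

    externalDegree : Fin n → ℕ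
    externalDegree x = indicator (¬? (Q? (successor x))) + indicator (¬? (Q? (predecessor x)))

    externalDegree≡0 : ∀ x → (∀ y → ¬ Q y → ¬ Adj x y) → externalDegree x ≡ 0
    externalDegree≡0 x no-exit with Q? (successor x) | Q? (predecessor x)
    ... | yes _ | yes _ = refl
    ... | no ¬q | _     = ⊥-elim (no-exit _ ¬q (Adj-successor x))
    ... | yes _ | no ¬q = ⊥-elim (no-exit _ ¬q (Adj-predecessor x))

    externalDegree≤1 : ∀ x → (∀ y y′ → ¬ Q y → ¬ Q y′ → Adj x y → Adj x y′ → y ≡ y′) →
                       externalDegree x ≤ 1
    externalDegree≤1 x one-exit with Q? (successor x) | Q? (predecessor x)
    ... | yes _ | yes _  = z≤n
    ... | yes _ | no _   = s≤s z≤n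
    ... | no _  | yes _  = s≤s z≤n
    ... | no ¬q | no ¬q′ = ⊥-elim (successor≢predecessor x
                             (one-exit _ _ ¬q ¬q′ (Adj-successor x) (Adj-predecessor x)))

    successor-outside : ∀ x → ¬ Q (successor x) → ¬ externalDegree x ≡ 0
    successor-outside x ¬q with Q? (successor x)
    ... | yes q = ⊥-elim (¬q q)
    ... | no _  = λ ()

    predecessor-outside : ∀ x → ¬ Q (predecessor x) → ¬ externalDegree x ≡ 0
    predecessor-outside x ¬q with Q? (predecessor x)
    ... | yes q = ⊥-elim (¬q q)
    ... | no _  = 0≢1+n ∘ sym ∘ trans (+-comm 1 _)

    both-outside : ∀ x → ¬ Q (successor x) → ¬ Q (predecessor x) → externalDegree x ≡ 2
    both-outside x ¬q ¬q′ with Q? (successor x) | Q? (predecessor x)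
    ... | no _  | no _  = refl
    ... | yes q | _     = ⊥-elim (¬q q)
    ... | no _  | yes q = ⊥-elim (¬q′ q)

    count+outside≡1 : ∀ {z xs} → Unique xs → All Q xs → (Q z → z ∈ xs) →
                      count _≟ᶠ_ z xs + indicator (¬? (Q? z)) ≡ 1
    count+outside≡1 {z} {xs} u all-Q complete with Q? z
    ... | yes q = trans (+-identityʳ _) (count-∈ _≟ᶠ_ u (complete q))
    ... | no ¬q = cong (_+ 1) (count-∉ _≟ᶠ_ (¬q ∘ All.lookup all-Q))

    cycle-degree : ∀ x {xs} → Unique xs → All Q xs → (∀ y → Q y → Adj x y → y ∈ xs) →
                   sum (map (cycleEdges x) xs) + externalDegree x ≡ 2
    cycle-degree x {xs} u all-Q complete = begin
      sum (map (cycleEdges x) xs) + externalDegree x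
        ≡⟨ cong (_+ externalDegree x) (sum-map-+ (λ y → indicator (y ≟ᶠ successor x))
                                                 (λ y → indicator (y ≟ᶠ predecessor x)) xs) ⟩
      count _≟ᶠ_ (successor x) xs + count _≟ᶠ_ (predecessor x) xs + externalDegree x
        ≡⟨ +-interchange (count _≟ᶠ_ (successor x) xs) _ _ _ ⟩
      (count _≟ᶠ_ (successor x) xs + indicator (¬? (Q? (successor x)))) +
      (count _≟ᶠ_ (predecessor x) xs + indicator (¬? (Q? (predecessor x))))
        ≡⟨ cong₂ _+_ (count+outside≡1 u all-Q (λ q → complete _ q (Adj-successor x)))
                     (count+outside≡1 u all-Q (λ q → complete _ q (Adj-predecessor x))) ⟩
      2 ∎
      where open ≡-Reasoning

    sum-externalDegree-bipartite : ∀ {A B} → Unique A → Unique B → All Q A → All Q B →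
      (∀ {a} → a ∈ A → ∀ y → Q y → Adj a y → y ∈ B) →
      (∀ {b} → b ∈ B → ∀ y → Q y → Adj b y → y ∈ A) →
      (∀ {b} → b ∈ B → ∀ y → ¬ Q y → ¬ Adj b y) →
      sum (map externalDegree A) + 2 * length B ≡ 2 * length A
    sum-externalDegree-bipartite {A} {B} uA uB all-QA all-QB A→B B→A B-internal = begin
      sum (map externalDegree A) + 2 * length B
        ≡⟨ cong (sum (map externalDegree A) +_) (sym (sum-map-const degree-B)) ⟩
      sum (map externalDegree A) + sum (map (λ b → sum (map (cycleEdges b) A)) B)
        ≡⟨ cong (sum (map externalDegree A) +_) edges-B≡edges-A ⟩
      sum (map externalDegree A) + sum (map (λ a → sum (map (cycleEdges a) B)) A)
        ≡⟨ +-comm (sum (map externalDegree A)) _ ⟩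
      sum (map (λ a → sum (map (cycleEdges a) B)) A) + sum (map externalDegree A)
        ≡⟨ sym (sum-map-+ (λ a → sum (map (cycleEdges a) B)) externalDegree A) ⟩
      sum (map (λ a → sum (map (cycleEdges a) B) + externalDegree a) A)
        ≡⟨ sum-map-const degree-A ⟩
      2 * length A ∎
      where
      open ≡-Reasoning
      degree-A : ∀ {a} → a ∈ A → sum (map (cycleEdges a) B) + externalDegree a ≡ 2
      degree-A a∈A = cycle-degree _ uB all-QB (A→B a∈A)
      degree-B : ∀ {b} → b ∈ B → sum (map (cycleEdges b) A) ≡ 2
      degree-B {b} b∈B = begin
        sum (map (cycleEdges b) A)
          ≡⟨ sym (+-identityʳ _) ⟩
        sum (map (cycleEdges b) A) + 0
          ≡⟨ cong (sum (map (cycleEdges b) A) +_) (sym (externalDegree≡0 b (B-internal b∈B))) ⟩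
        sum (map (cycleEdges b) A) + externalDegree b
          ≡⟨ cycle-degree b uA all-QA (B→A b∈B) ⟩
        2 ∎
      edges-B≡edges-A : sum (map (λ b → sum (map (cycleEdges b) A)) B) ≡
                        sum (map (λ a → sum (map (cycleEdges a) B)) A)
      edges-B≡edges-A = begin
        sum (map (λ b → sum (map (cycleEdges b) A)) B)
          ≡⟨ cong sum (map-cong (λ b → cong sum (map-cong (cycleEdges-sym b) A)) B) ⟩
        sum (map (λ b → sum (map (λ a → cycleEdges a b) A)) B)
          ≡⟨ sym (sum-map-swap cycleEdges A B) ⟩
        sum (map (λ a → sum (map (cycleEdges a) B)) A) ∎

    Crossing : Fin n → Fin n → Set
    Crossing i j = Next n i j × ((Q (order i) × ¬ Q (order j)) ⊎ (¬ Q (order i) × Q (order j)))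

    ExactlyTwoCrossings : Set
    ExactlyTwoCrossings = ∃[ i₁ ] ∃[ j₁ ] ∃[ i₂ ] ∃[ j₂ ]
      (¬ i₁ ≡ i₂ × Crossing i₁ j₁ × Crossing i₂ j₂ × (∀ i j → Crossing i j → i ≡ i₁ ⊎ i ≡ i₂))

    CrossesThrough : Fin n → Fin n → Fin n → Set
    CrossesThrough i j x = (order i ≡ x × ¬ Q (order j)) ⊎ (¬ Q (order i) × order j ≡ x)

    crossing-vertex : ∀ {i j} → Crossing i j → ∃[ x ] (Q x × CrossesThrough i j x)
    crossing-vertex (_ , inj₁ (q , ¬q)) = _ , q , inj₁ (refl , ¬q)
    crossing-vertex (_ , inj₂ (¬q , q)) = _ , q , inj₂ (¬q , refl)

    CrossesThrough⇒externalDegree≢0 : ∀ {i j x} → Next n i j → CrossesThrough i j x →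
                                      ¬ externalDegree x ≡ 0
    CrossesThrough⇒externalDegree≢0 i→j (inj₁ (refl , ¬q)) =
      successor-outside _ (¬q ∘ subst Q (sym (Next⇒successor i→j)))
    CrossesThrough⇒externalDegree≢0 i→j (inj₂ (¬q , refl)) =
      predecessor-outside _ (¬q ∘ subst Q (sym (Next⇒predecessor i→j)))

    externalDegree≢0⇒crossing : ∀ {x} → Q x → ¬ externalDegree x ≡ 0 →
                                ∃[ i ] ∃[ j ] (Crossing i j × CrossesThrough i j x)
    externalDegree≢0⇒crossing {x} q ext≢0 with Q? (successor x) | Q? (predecessor x)
    ... | no ¬q | _ = position x , proj₁ (next (position x)) ,
          (proj₂ (next _) , inj₁ (subst Q (sym (order-position x)) q , ¬q)) , inj₁ (order-position x , ¬q)
    ... | yes _ | no ¬q = proj₁ (prev (position x)) , position x ,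
          (proj₂ (prev _) , inj₂ (¬q , subst Q (sym (order-position x)) q)) , inj₂ (¬q , order-position x)
    ... | yes _ | yes _ = ⊥-elim (ext≢0 refl)

    CrossesThrough-functional : ∀ {i j x x′} → Q x → Q x′ →
                                CrossesThrough i j x → CrossesThrough i j x′ → x ≡ x′
    CrossesThrough-functional _ _  (inj₁ (i≡x , _)) (inj₁ (i≡x′ , _)) = trans (sym i≡x) i≡x′
    CrossesThrough-functional _ q′ (inj₁ (_ , ¬q))  (inj₂ (_ , j≡x′)) =
      ⊥-elim (¬q (subst Q (sym j≡x′) q′))
    CrossesThrough-functional _ q′ (inj₂ (¬q , _))  (inj₁ (i≡x′ , _)) =
      ⊥-elim (¬q (subst Q (sym i≡x′) q′))
    CrossesThrough-functional _ _  (inj₂ (_ , j≡x)) (inj₂ (_ , j≡x′)) = trans (sym j≡x) j≡x′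

    CrossesThrough-injective : ∀ {i j i′ j′ x} → externalDegree x ≤ 1 → Next n i j → Next n i′ j′ →
                               CrossesThrough i j x → CrossesThrough i′ j′ x → i ≡ i′
    CrossesThrough-injective _ _ _ (inj₁ (i≡x , _)) (inj₁ (i′≡x , _)) = inj (trans i≡x (sym i′≡x))
    CrossesThrough-injective {i′ = i′} _ i→j i′→j′ (inj₂ (_ , j≡x)) (inj₂ (_ , j′≡x)) =
      Next-injective i→j (subst (Next n i′) (inj (trans j′≡x (sym j≡x))) i′→j′)
    CrossesThrough-injective ext≤1 i→j i′→j′ (inj₁ (refl , ¬q)) (inj₂ (¬q′ , j′≡x)) =
      ⊥-elim (≤⇒≯ ext≤1 (≤-reflexive (sym (both-outside _
        (¬q ∘ subst Q (sym (Next⇒successor i→j)))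
        (¬q′ ∘ subst Q (trans (cong predecessor (sym j′≡x)) (sym (Next⇒predecessor i′→j′))))))))
    CrossesThrough-injective ext≤1 i→j i′→j′ (inj₂ (¬q , j≡x)) (inj₁ (refl , ¬q′)) =
      ⊥-elim (≤⇒≯ ext≤1 (≤-reflexive (sym (both-outside _
        (¬q′ ∘ subst Q (sym (Next⇒successor i′→j′)))
        (¬q ∘ subst Q (trans (cong predecessor (sym j≡x)) (sym (Next⇒predecessor i→j))))))))

    exactlyTwoCrossings : ∀ xs → Unique xs → All Q xs → (∀ {x} → Q x → x ∈ xs) →
                          (∀ {x} → Q x → externalDegree x ≤ 1) → sum (map externalDegree xs) ≡ 2 →
                          ExactlyTwoCrossings
    exactlyTwoCrossings xs u all-Q complete ext≤1 sum≡2
      with two-nonzero externalDegree u (ext≤1 ∘ All.lookup all-Q) sum≡2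
    ... | x₁ , x₂ , x₁≢x₂ , (x₁∈ , ext₁≢0) , (x₂∈ , ext₂≢0) , only
      with externalDegree≢0⇒crossing (All.lookup all-Q x₁∈) ext₁≢0
         | externalDegree≢0⇒crossing (All.lookup all-Q x₂∈) ext₂≢0
    ... | i₁ , j₁ , c₁ , at₁ | i₂ , j₂ , c₂ , at₂ =
      i₁ , j₁ , i₂ , j₂ , i₁≢i₂ , c₁ , c₂ , only-crossings
      where
      i₁≢i₂ : ¬ i₁ ≡ i₂
      i₁≢i₂ refl = x₁≢x₂ (CrossesThrough-functional (All.lookup all-Q x₁∈) (All.lookup all-Q x₂∈) at₁
        (subst (λ j → CrossesThrough i₁ j x₂) (Next-functional (proj₁ c₂) (proj₁ c₁)) at₂))
      only-crossings : ∀ i j → Crossing i j → i ≡ i₁ ⊎ i ≡ i₂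
      only-crossings i j c with crossing-vertex c
      ... | x , q , at with only (complete q) (CrossesThrough⇒externalDegree≢0 (proj₁ c) at)
      ...   | inj₁ refl = inj₁ (CrossesThrough-injective (ext≤1 q) (proj₁ c) (proj₁ c₁) at at₁)
      ...   | inj₂ refl = inj₂ (CrossesThrough-injective (ext≤1 q) (proj₁ c) (proj₁ c₂) at at₂)

    exactlyTwoCrossings-bipartite : ∀ {A B} → Unique A → Unique B → Disjoint A B → All Q A → All Q B →
      (∀ {x} → Q x → x ∈ A ++ B) →
      (∀ {a} → a ∈ A → ∀ y → Q y → Adj a y → y ∈ B) →
      (∀ {b} → b ∈ B → ∀ y → Q y → Adj b y → y ∈ A) →
      (∀ {b} → b ∈ B → ∀ y → ¬ Q y → ¬ Adj b y) →
      (∀ {x} → Q x → ∀ y y′ → ¬ Q y → ¬ Q y′ → Adj x y → Adj x y′ → y ≡ y′) →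
      length A ≡ suc (length B) →
      ExactlyTwoCrossings
    exactlyTwoCrossings-bipartite {A} {B} uA uB A∩B≡∅ all-QA all-QB complete A→B B→A B-internal one-exit
                                  |A|≡1+|B| =
      exactlyTwoCrossings (A ++ B) (Unique.++⁺ uA uB A∩B≡∅) (AllP.++⁺ all-QA all-QB) complete
        (λ q → externalDegree≤1 _ (one-exit q)) (begin
          sum (map externalDegree (A ++ B))
            ≡⟨ cong sum (map-++ externalDegree A B) ⟩
          sum (map externalDegree A ++ map externalDegree B)
            ≡⟨ sum-++ (map externalDegree A) (map externalDegree B) ⟩
          sum (map externalDegree A) + sum (map externalDegree B)
            ≡⟨ cong₂ _+_ sum-A sum-B ⟩
          2 ∎)
      where
      open ≡-Reasoning
      sum-A : sum (map externalDegree A) ≡ 2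
      sum-A = +-cancelʳ-≡ (2 * length B) (sum (map externalDegree A)) 2 (begin
        sum (map externalDegree A) + 2 * length B
          ≡⟨ sum-externalDegree-bipartite uA uB all-QA all-QB A→B B→A B-internal ⟩
        2 * length A       ≡⟨ cong (2 *_) |A|≡1+|B| ⟩
        2 * suc (length B) ≡⟨ *-suc 2 (length B) ⟩
        2 + 2 * length B   ∎)
      sum-B : sum (map externalDegree B) ≡ 0
      sum-B = sum-map-const {g = externalDegree} {c = 0} {B} (λ b∈B → externalDegree≡0 _ (B-internal b∈B))

even odd : ℕ → Bool
even zero    = true
even (suc n) = odd n
odd  zero    = false
odd  (suc n) = even n

even⊎odd : ∀ n → T (even n) ⊎ T (odd n)
even⊎odd zero    = inj₁ tt
even⊎odd (suc n) = Sum.swap (even⊎odd n)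

¬even∧odd : ∀ n → T (even n) → T (odd n) → ⊥
¬even∧odd zero    _ ()
¬even∧odd (suc n) o e = ¬even∧odd n e o

even-double : ∀ j → T (even (2 * j))
even-double zero    = tt
even-double (suc j) = subst (T ∘ even) (sym (*-suc 2 j)) (even-double j)

evens odds : ℕ → ℕ
evens n = length (filter (λ i → T? (even (toℕ i))) (allFin n))
odds  n = length (filter (λ i → T? (odd (toℕ i))) (allFin n))

allFin-suc : ∀ n → allFin (suc n) ≡ zero ∷ map suc (allFin n)
allFin-suc n = cong (zero ∷_) (sym (map-tabulate id suc))

evens-suc : ∀ n → evens (suc n) ≡ suc (odds n)
evens-suc n = begin
  evens (suc n)
    ≡⟨ cong (length ∘ filter (λ i → T? (even (toℕ i)))) (allFin-suc n) ⟩
  suc (length (filter (λ i → T? (even (toℕ i))) (map suc (allFin n))))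
    ≡⟨ cong (suc ∘ length) (filter-map (λ i → T? (even (toℕ i))) suc (allFin n)) ⟩
  suc (length (map suc (filter (λ i → T? (odd (toℕ i))) (allFin n))))
    ≡⟨ cong suc (length-map (Fin.suc {n}) (filter (λ i → T? (odd (toℕ i))) (allFin n))) ⟩
  suc (odds n) ∎
  where open ≡-Reasoning

odds-suc : ∀ n → odds (suc n) ≡ evens n
odds-suc n = begin
  odds (suc n)
    ≡⟨ cong (length ∘ filter (λ i → T? (odd (toℕ i)))) (allFin-suc n) ⟩
  length (filter (λ i → T? (odd (toℕ i))) (map suc (allFin n)))
    ≡⟨ cong length (filter-map (λ i → T? (odd (toℕ i))) suc (allFin n)) ⟩
  length (map suc (filter (λ i → T? (even (toℕ i))) (allFin n)))
    ≡⟨ length-map (Fin.suc {n}) (filter (λ i → T? (even (toℕ i))) (allFin n)) ⟩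
  evens n ∎
  where open ≡-Reasoning

evens≡odds : ∀ r → evens (2 * r) ≡ odds (2 * r)
evens≡odds zero    = refl
evens≡odds (suc r) = begin
  evens (2 * suc r)           ≡⟨ cong evens (*-suc 2 r) ⟩
  evens (2 + 2 * r)           ≡⟨ evens-suc (suc (2 * r)) ⟩
  suc (odds (suc (2 * r)))    ≡⟨ cong suc (odds-suc (2 * r)) ⟩
  suc (evens (2 * r))         ≡⟨ cong suc (evens≡odds r) ⟩
  suc (odds (2 * r))          ≡⟨ sym (evens-suc (2 * r)) ⟩
  evens (suc (2 * r))         ≡⟨ sym (odds-suc (suc (2 * r))) ⟩
  odds (2 + 2 * r)            ≡⟨ cong odds (sym (*-suc 2 r)) ⟩
  odds (2 * suc r)            ∎
  where open ≡-Reasoning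

evens≡1+odds : ∀ r → evens (suc (2 * r)) ≡ suc (odds (suc (2 * r)))
evens≡1+odds r =
  trans (evens-suc (2 * r)) (cong suc (trans (sym (evens≡odds r)) (sym (odds-suc (2 * r)))))

module GateSides (s : ℕ) where

  -- inj₂ k is b_{k+1}, so it lies in A exactly when k is even.
  onA onB : GateV s → Bool
  onA (inj₁ x) = lookup (true ∷ true ∷ false ∷ true ∷ false ∷ false ∷ true ∷ false ∷ true ∷ false ∷ []) x
  onA (inj₂ k) = even (toℕ k)
  onB (inj₁ x) = not (onA (inj₁ x))
  onB (inj₂ k) = odd (toℕ k)

  OnA OnB : GateV s → Set
  OnA = T ∘ onA
  OnB = T ∘ onB

  OnA⊎OnB : ∀ u → OnA u ⊎ OnB u
  OnA⊎OnB (inj₁ x) with onA (inj₁ x)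
  ... | true  = inj₁ tt
  ... | false = inj₂ tt
  OnA⊎OnB (inj₂ k) = even⊎odd (toℕ k)

  ¬OnA∧OnB : ∀ u → OnA u → OnB u → ⊥
  ¬OnA∧OnB (inj₁ x) with onA (inj₁ x)
  ... | true  = λ _ ()
  ... | false = λ ()
  ¬OnA∧OnB (inj₂ k) = ¬even∧odd (toℕ k)

  Attachment⇒OnA : ∀ {u} → Attachment s u → OnA u
  Attachment⇒OnA at1 = tt
  Attachment⇒OnA at2 = tt
  Attachment⇒OnA at9 = tt
  Attachment⇒OnA (atb k j k+1≡2j+1) =
    subst (T ∘ even) (sym (suc-injective (trans k+1≡2j+1 (+-comm (2 * j) 1)))) (even-double j)

  innerVertices chainVertices gateVertices : List (GateV s)
  innerVertices = map inj₁ (allFin 10)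
  chainVertices = map inj₂ (allFin (2 * s ∸ 7))
  gateVertices  = innerVertices ++ chainVertices

  ∈-gateVertices : ∀ u → u ∈ gateVertices
  ∈-gateVertices (inj₁ x) = ∈-++⁺ˡ (∈-map⁺ inj₁ (∈-allFin x))
  ∈-gateVertices (inj₂ k) = ∈-++⁺ʳ innerVertices (∈-map⁺ inj₂ (∈-allFin k))

  gateVertices-unique : Unique gateVertices
  gateVertices-unique = Unique.++⁺ (Unique.map⁺ inj₁-injective (Unique.allFin⁺ 10))
                                   (Unique.map⁺ inj₂-injective (Unique.allFin⁺ _))
                                   inj₁≢inj₂
    where
    inj₁-injective : ∀ {x y : Fin 10} → _≡_ {A = GateV s} (inj₁ x) (inj₁ y) → x ≡ y
    inj₁-injective refl = refl
    inj₂-injective : ∀ {k l : Fin (2 * s ∸ 7)} → _≡_ {A = GateV s} (inj₂ k) (inj₂ l) → k ≡ l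
    inj₂-injective refl = refl
    inj₁≢inj₂ : Disjoint innerVertices chainVertices
    inj₁≢inj₂ (u∈₁ , u∈₂) with ∈-map⁻ inj₁ u∈₁ | ∈-map⁻ inj₂ u∈₂
    ... | _ , _ , refl | _ , _ , ()

  sideA sideB : List (GateV s)
  sideA = filter (T? ∘ onA) gateVertices
  sideB = filter (T? ∘ onB) gateVertices

  length-sideA : length sideA ≡ 5 + evens (2 * s ∸ 7)
  length-sideA = begin
    length sideA
      ≡⟨ cong length (filter-++ (T? ∘ onA) innerVertices chainVertices) ⟩
    5 + length (filter (T? ∘ onA) chainVertices)
      ≡⟨ cong ((5 +_) ∘ length) (filter-map (T? ∘ onA) inj₂ (allFin (2 * s ∸ 7))) ⟩
    5 + length (map inj₂ evenIndices)
      ≡⟨ cong (5 +_) (length-map inj₂ evenIndices) ⟩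
    5 + evens (2 * s ∸ 7) ∎
    where
    open ≡-Reasoning
    evenIndices = filter (λ k → T? (even (toℕ k))) (allFin (2 * s ∸ 7))

  length-sideB : length sideB ≡ 5 + odds (2 * s ∸ 7)
  length-sideB = begin
    length sideB
      ≡⟨ cong length (filter-++ (T? ∘ onB) innerVertices chainVertices) ⟩
    5 + length (filter (T? ∘ onB) chainVertices)
      ≡⟨ cong ((5 +_) ∘ length) (filter-map (T? ∘ onB) inj₂ (allFin (2 * s ∸ 7))) ⟩
    5 + length (map inj₂ oddIndices)
      ≡⟨ cong (5 +_) (length-map inj₂ oddIndices) ⟩
    5 + odds (2 * s ∸ 7) ∎
    where
    open ≡-Reasoning
    oddIndices = filter (λ k → T? (odd (toℕ k))) (allFin (2 * s ∸ 7))

module GateBipartition (r : ℕ) where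
  open GateSides (4 + r)

  chain-length : 2 * (4 + r) ∸ 7 ≡ suc (2 * r)
  chain-length = cong (_∸ 7) (*-distribˡ-+ 2 4 r)

  sides-balance : length sideA ≡ suc (length sideB)
  sides-balance = begin
    length sideA                       ≡⟨ length-sideA ⟩
    5 + evens (2 * (4 + r) ∸ 7)        ≡⟨ cong (λ m → 5 + evens m) chain-length ⟩
    5 + evens (suc (2 * r))            ≡⟨ cong (5 +_) (evens≡1+odds r) ⟩
    6 + odds (suc (2 * r))             ≡⟨ cong (λ m → 6 + odds m) (sym chain-length) ⟩
    6 + odds (2 * (4 + r) ∸ 7)         ≡⟨ cong suc (sym length-sideB) ⟩
    suc (length sideB)                 ∎
    where open ≡-Reasoning

  GateEdge-sides : ∀ {u w} → GateEdge (4 + r) u w → (OnA u × OnB w) ⊎ (OnB u × OnA w)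
  GateEdge-sides e1-3  = inj₁ (tt , tt)
  GateEdge-sides e1-8  = inj₁ (tt , tt)
  GateEdge-sides e2-3  = inj₁ (tt , tt)
  GateEdge-sides e2-5  = inj₁ (tt , tt)
  GateEdge-sides e3-4  = inj₂ (tt , tt)
  GateEdge-sides e4-5  = inj₁ (tt , tt)
  GateEdge-sides e4-6  = inj₁ (tt , tt)
  GateEdge-sides e6-7  = inj₂ (tt , tt)
  GateEdge-sides e7-8  = inj₁ (tt , tt)
  GateEdge-sides e7-10 = inj₁ (tt , tt)
  GateEdge-sides e8-9  = inj₂ (tt , tt)
  GateEdge-sides e9-10 = inj₁ (tt , tt)
  GateEdge-sides (e5-b1 k k≡0) = inj₂ (tt , subst (T ∘ even) (sym k≡0) tt)
  GateEdge-sides (e10-blast k k+1≡m) =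
    inj₂ (tt , subst (T ∘ even) (sym (suc-injective (trans k+1≡m chain-length))) (even-double r))
  GateEdge-sides (eb-b k l l≡k+1) with even⊎odd (toℕ k)
  ... | inj₁ k-even = inj₁ (k-even , subst (T ∘ odd) (sym l≡k+1) k-even)
  ... | inj₂ k-odd  = inj₂ (k-odd , subst (T ∘ even) (sym l≡k+1) k-odd)
  GateEdge-sides (e1-beven k j _ _ k+1≡2j) = inj₁ (tt , subst (T ∘ even) (sym k+1≡2j) (even-double j))

  GateAdj-sides : ∀ {u w} → GateAdj (4 + r) u w → (OnA u × OnB w) ⊎ (OnB u × OnA w)
  GateAdj-sides (inj₁ uw) = GateEdge-sides uw
  GateAdj-sides (inj₂ wu) = Sum.swap (Sum.map Product.swap Product.swap (GateEdge-sides wu))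

  OnA-neighbour : ∀ {u w} → OnA u → GateAdj (4 + r) u w → OnB w
  OnA-neighbour {u} a uw with GateAdj-sides uw
  ... | inj₁ (_ , b)  = b
  ... | inj₂ (b , _)  = ⊥-elim (¬OnA∧OnB u a b)

  OnB-neighbour : ∀ {u w} → OnB u → GateAdj (4 + r) u w → OnA w
  OnB-neighbour {u} b uw with GateAdj-sides uw
  ... | inj₁ (a , _)  = ⊥-elim (¬OnA∧OnB u a b)
  ... | inj₂ (_ , a)  = a

module GateCopy {r n} {G : Graph n} {f : GateV (4 + r) → Fin n}
                (copy : IsInducedCopy G (4 + r) f) (ext : ExternalEdgesCondition G (4 + r) f) where
  open Graph G using (Adj)
  open GateSides (4 + r)
  open GateBipartition r

  H : Fin n → Set
  H = InH G (4 + r) f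

  H? : Decidable H
  H? x with any? (λ i → f (inj₁ i) ≟ᶠ x) | any? (λ k → f (inj₂ k) ≟ᶠ x)
  ... | yes (i , fi≡x) | _              = yes (inj₁ i , fi≡x)
  ... | no _           | yes (k , fk≡x) = yes (inj₂ k , fk≡x)
  ... | no ¬i          | no ¬k          =
    no λ { (inj₁ i , fi≡x) → ¬i (i , fi≡x) ; (inj₂ k , fk≡x) → ¬k (k , fk≡x) }

  -- Attachment need not be decidable here: the conclusion is a decidable equality.
  unique-external-neighbour : ∀ {x} → H x → ∀ y y′ → ¬ H y → ¬ H y′ → Adj x y → Adj x y′ → y ≡ y′
  unique-external-neighbour (u , refl) y y′ ¬y ¬y′ adj adj′ =
    decidable-stable (y ≟ᶠ y′) λ y≢y′ → ¬¬-excluded-middle λ where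
      (yes att) → let (_ , _ , only) = proj₁ ext u att in
                  y≢y′ (trans (only y ¬y adj) (sym (only y′ ¬y′ adj′)))
      (no ¬att) → proj₂ ext u ¬att y ¬y adj

  image : (GateV (4 + r) → Bool) → List (Fin n)
  image side = map f (filter (T? ∘ side) gateVertices)

  ∈-image⁺ : ∀ side {u} → T (side u) → f u ∈ image side
  ∈-image⁺ side {u} p = ∈-map⁺ f (∈-filter⁺ (T? ∘ side) (∈-gateVertices u) p)

  ∈-image⁻ : ∀ side {x} → x ∈ image side → ∃[ u ] (x ≡ f u × T (side u))
  ∈-image⁻ side x∈ with ∈-map⁻ f x∈
  ... | u , u∈ , x≡fu = u , x≡fu , proj₂ (∈-filter⁻ (T? ∘ side) u∈)

  image-unique : ∀ side → Unique (image side)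
  image-unique side = Unique.map⁺ (proj₁ copy) (Unique.filter⁺ (T? ∘ side) gateVertices-unique)

  image-H : ∀ side → All H (image side)
  image-H side = All.tabulate λ x∈ → let (u , x≡fu , _) = ∈-image⁻ side x∈ in u , sym x≡fu

  neighbours-across : ∀ side side′ → (∀ {u w} → T (side u) → GateAdj (4 + r) u w → T (side′ w)) →
                      ∀ {x} → x ∈ image side → ∀ y → H y → Adj x y → y ∈ image side′
  neighbours-across side side′ across x∈ _ (w , refl) adj with ∈-image⁻ side x∈
  ... | u , refl , p = ∈-image⁺ side′ (across p (proj₂ (proj₂ copy u w) adj))

  onB-internal : ∀ {x} → x ∈ image onB → ∀ y → ¬ H y → ¬ Adj x y
  onB-internal x∈ with ∈-image⁻ onB x∈
  ... | u , refl , b = proj₂ ext u (λ att → ¬OnA∧OnB u (Attachment⇒OnA att) b)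

  images-disjoint : Disjoint (image onA) (image onB)
  images-disjoint (x∈A , x∈B) with ∈-image⁻ onA x∈A | ∈-image⁻ onB x∈B
  ... | u , refl , a | w , fu≡fw , b = ¬OnA∧OnB u a (subst OnB (sym (proj₁ copy fu≡fw)) b)

  images-complete : ∀ {x} → H x → x ∈ image onA ++ image onB
  images-complete (u , refl) with OnA⊎OnB u
  ... | inj₁ a = ∈-++⁺ˡ (∈-image⁺ onA a)
  ... | inj₂ b = ∈-++⁺ʳ (image onA) (∈-image⁺ onB b)

  images-balance : length (image onA) ≡ suc (length (image onB))
  images-balance = trans (length-map f sideA) (trans sides-balance (cong suc (sym (length-map f sideB))))

proposition4p4 : (s : ℕ) → 4 ≤ s → (n : ℕ) → (G : Graph n) →
    (f : GateV s → Fin n) → IsInducedCopy G s f →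
    (∃[ w ] ¬ InH G s f w) → ExternalEdgesCondition G s f →
    (C : HamiltonianCycle G) → ExactlyTwoExternal G s f C
proposition4p4 (suc (suc (suc (suc r)))) (s≤s (s≤s (s≤s (s≤s z≤n)))) n G f copy _ ext C =
  exactlyTwoCrossings-bipartite (image-unique onA) (image-unique onB) images-disjoint
    (image-H onA) (image-H onB) images-complete
    (neighbours-across onA onB OnA-neighbour) (neighbours-across onB onA OnB-neighbour) onB-internal
    unique-external-neighbour images-balance
  where
  open GateSides (4 + r)
  open GateBipartition r
  open GateCopy {G = G} copy ext
  open CycleNeighbours C
  open Boundary H H?
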